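{- Let $r\ge 3$ be an integer, let $\varphi$ be an instance of \textsc{Exact $r$-SAT}, and let $G(\varphi)$ be the graph constructed from $\varphi$ as described in the context. If $\varphi$ is satisfiable, then $\mathrm{wcol}_r(G(\varphi))\le 2r-1$.
   Context: \textsc{Exact $r$-SAT}: a CNF formula $\varphi$ with clauses $c_1,\dots,c_m$ over variables $x_1,\dots,x_n$ such that each clause contains exactly $r$ different variables. An $\ell$-subdivided edge between $a$ and $b$ is an induced path with $\ell$ new internal vertices (with no other neighbours) joining $a$ and $b$; a $0$-subdivided edge is an ordinary edge. Construction of $G(\varphi)$: for each clause $c_i$ create $2r$ vertices $u_i^1,\dots,u_i^{2r}$. For each variable $x_j$ create two adjacent vertices $v_j$ (for $x_j$) and $v_j'$ (for $\overline{x}_j$). For each clause $c_i$ containing the literal $x_j$, add two $(r-2)$-subdivided edges from $v_j$ to each of $u_i^1,\dots,u_i^{2r}$; for each clause $c_i$ containing $\overline{x}_j$, add two $(r-2)$-subdivided edges from $v_j'$ to each of $u_i^1,\dots,u_i^{2r}$. Weak coloring number: for a total order $\sigma$ on $V(G)$ and $u\neq v$, $v$ is weakly $r$-reachable from $u$ if $v\not<_\sigma u$ and there is a $u$-$v$ path $P$ of length at most $r$ whose internal vertices $p$ all satisfy $p<_\sigma v$; $\mathrm{wreach}_r(u,G_\sigma)$ is the set of such $v$, and $\mathrm{wcol}_r(G)=\min_\sigma\max_u|\mathrm{wreach}_r(u,G_\sigma)|$ over total orders $\sigma$. -}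

module Defs where

open import Data.Nat using (ℕ; zero; suc; _+_; _*_; _∸_; _≤_; _<_)
open import Data.Fin using (Fin; toℕ)
open import Data.Bool using (Bool; true; false)
open import Data.Product using (Σ; ∃; _×_; _,_; proj₁; proj₂)
open import Data.Sum using (_⊎_)
open import Data.List using (List; []; _∷_; _++_; length)
open import Data.List.Membership.Propositional using (_∈_)
open import Data.List.Relation.Unary.All using (All)
open import Data.List.Relation.Unary.Unique.Propositional using (Unique)
open import Relation.Binary.PropositionalEquality using (_≡_; _≢_)
open import Function.Definitions using (Injective)

-- A literal is a pair (variable, sign); sign true = x_j, false = ¬x_j.

Literal : ℕ → Set
Literal n = Fin n × Bool

record Instance (r : ℕ) : Set where
  field
    n        : ℕ
    m        : ℕ
    lit      : Fin m → Fin r → Literal n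
    distinct : ∀ i p q → proj₁ (lit i p) ≡ proj₁ (lit i q) → p ≡ q

open Instance public

Satisfiable : ∀ {r} → Instance r → Set
Satisfiable {r} φ =
  Σ (Fin (n φ) → Bool) λ α →
    ∀ (i : Fin (m φ)) → Σ (Fin r) λ p → α (proj₁ (lit φ i p)) ≡ proj₂ (lit φ i p)

record Graph : Set₁ where
  field
    V   : Set
    Adj : V → V → Set

open Graph public

data Vtx (r n m : ℕ) : Set where
  uV  : Fin m → Fin (2 * r) → Vtx r n m
  pos : Fin n → Vtx r n m
  neg : Fin n → Vtx r n m
  -- internal vertex t (of r-2) of copy c (of the two) of the subdivided
  -- edge between the vertex of literal p of clause i and u_i^k
  sub : Fin m → Fin r → Fin (2 * r) → Fin 2 → Fin (r ∸ 2) → Vtx r n m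

litVertex : ∀ {r n m} → Literal n → Vtx r n m
litVertex (j , true)  = pos j
litVertex (j , false) = neg j

module _ {r : ℕ} (φ : Instance r) where

  VG : Set
  VG = Vtx r (n φ) (m φ)

  data Edge : VG → VG → Set where
    var   : ∀ j → Edge (pos j) (neg j)
    first : ∀ i p k c t → toℕ t ≡ 0 →
            Edge (litVertex (lit φ i p)) (sub i p k c t)
    step  : ∀ i p k c t t' → toℕ t' ≡ suc (toℕ t) →
            Edge (sub i p k c t) (sub i p k c t')
    last  : ∀ i p k c t → suc (toℕ t) ≡ r ∸ 2 →
            Edge (sub i p k c t) (uV i k)

  G : Graph
  G = record { V = VG ; Adj = λ a b → Edge a b ⊎ Edge b a }

module _ (H : Graph) where

  Chain : V H → List (V H) → V H → Set
  Chain a []       b = Adj H a b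
  Chain a (x ∷ xs) b = Adj H a x × Chain x xs b

  -- a total order σ on V(H) is given by an injective rank : V H → ℕ,
  -- with  a <σ b  iff  rank a < rank b.
  -- v is weakly ℓ-reachable from u: u ≢ v, not (v <σ u), and there is a
  -- u–v path (distinct vertices u, xs, v) of length (length xs + 1) ≤ ℓ
  -- all of whose internal vertices are <σ v.
  WReach : ℕ → (V H → ℕ) → V H → V H → Set
  WReach ℓ rank u v =
    u ≢ v × rank u ≤ rank v ×
    Σ (List (V H)) λ xs →
      Chain u xs v × Unique (u ∷ xs ++ v ∷ []) ×
      length xs + 1 ≤ ℓ × All (λ p → rank p < rank v) xs

  AtMost : ℕ → (V H → Set) → Set
  AtMost k P = Σ (List (V H)) λ L → length L ≤ k × (∀ x → P x → x ∈ L)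

  -- wcol_ℓ(H) ≤ k  (wcol is a minimum over orders of a maximum over vertices)
  WcolAtMost : ℕ → ℕ → Set
  WcolAtMost ℓ k =
    Σ (V H → ℕ) λ rank → Injective _≡_ _≡_ rank ×
      (∀ u → AtMost k (WReach ℓ rank u))

-- Fix a satisfying assignment and order the vertices: first all subdivision vertices, then the
-- vertices u_i^k, then the literal vertices, the true literal of each variable after its
-- negation. From a literal vertex, the literal vertices of other variables are at distance at
-- least 2r − 2 > r, and all other vertices come earlier. From u_i^k, the only literal vertices
-- within distance r are the r literals of clause i and their negations; a negation of a true
-- literal is reachable in r steps only through that literal, which is ordered after it, so at
-- most r + (r − 1) vertices are weakly r-reachable. From a subdivision vertex on the edge from
-- literal l of clause i to u_i^k one can weakly reach only the other r − 3 vertices of that edge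
-- (every other subdivision vertex lies behind a later vertex), u_i^k, the r literals of clause i
-- and the negation of l: 2r − 1 vertices. Each of these bounds on reachability is an invariant of
-- walks, indexed by the number of steps.

module Submission where

open import Defs
open import Data.Nat using (ℕ; zero; suc; _+_; _*_; _∸_; _≤_; _<_; z≤n; s≤s)
open import Data.Nat.Properties hiding (_≟_)
open import Data.Fin using (Fin; zero; suc; toℕ; combine; punchIn; punchOut; _≟_)
open import Data.Fin.Properties using (toℕ-injective; toℕ<n; toℕ-combine; combine-injective; punchIn-punchOut)
open import Data.Bool using (Bool; true; false; not)
open import Data.Product using (∃-syntax; _×_; _,_; proj₁; proj₂)
open import Data.Sum using (_⊎_; inj₁; inj₂)
open import Data.Sum.Properties using (inj₁-injective; inj₂-injective)
open import Data.Unit using (⊤; tt)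
open import Data.Empty using (⊥-elim)
open import Data.List using (List; []; _∷_; _++_; length; map; allFin)
open import Data.List.Properties using (length-map; length-++; length-tabulate)
open import Data.List.Relation.Unary.All as All using (All; []; _∷_)
open import Data.List.Relation.Unary.Any using (here; there)
open import Data.List.Membership.Propositional using (_∈_)
open import Data.List.Membership.Propositional.Properties using (∈-map⁺; ∈-++⁺ˡ; ∈-++⁺ʳ; ∈-allFin)
open import Function using (_∘_)
open import Function.Definitions using (Injective)
open import Relation.Binary.PropositionalEquality
open import Relation.Nullary using (¬_; yes; no)

module _ (H : Graph) (Allowed : V H → Set) (P : ℕ → V H → Set)
         (step : ∀ {ℓ x y} → Allowed x → P ℓ x → Adj H x y → P (suc ℓ) y) where

  invariant-along-Chain : ∀ {ℓ a v} xs → Allowed a → All Allowed xs → P ℓ a → Chain H a xs v →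
                          P (length xs + suc ℓ) v
  invariant-along-Chain []       ok-a []             pa a~v        = step ok-a pa a~v
  invariant-along-Chain {ℓ} {v = v} (x ∷ xs) ok-a (ok-x ∷ ok-xs) pa (a~x , x~v) =
    subst (λ d → P d v) (+-suc (length xs) (suc ℓ))
      (invariant-along-Chain xs ok-x ok-xs (step ok-a pa a~x) x~v)

length-map-allFin : ∀ {A : Set} n (f : Fin n → A) → length (map f (allFin n)) ≡ n
length-map-allFin n f = trans (length-map f (allFin n)) (length-tabulate (λ i → i))

∈-map-punchIn : ∀ {A : Set} {n} (f : Fin (suc n) → A) {i j} → i ≢ j →
                f j ∈ map (f ∘ punchIn i) (allFin n)
∈-map-punchIn f {i} i≢j =
  subst (λ x → f x ∈ _) (punchIn-punchOut i≢j) (∈-map⁺ (f ∘ punchIn i) (∈-allFin (punchOut i≢j)))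

<-≢-+ : ∀ {a s} b → a < s → a ≢ s + b
<-≢-+ b a<s = <⇒≢ (<-≤-trans a<s (m≤m+n _ b))

toℕ-combine-zero<toℕ-combine-one : ∀ {m} (j : Fin m) →
                                  toℕ (combine j (zero {1})) < toℕ (combine j (suc (zero {0})))
toℕ-combine-zero<toℕ-combine-one j rewrite toℕ-combine j (zero {1}) | toℕ-combine j (suc (zero {0})) =
  +-monoʳ-< (2 * toℕ j) (s≤s z≤n)

m+[m∸1]≡2*m∸1 : ∀ m → m + (m ∸ 1) ≡ 2 * m ∸ 1
m+[m∸1]≡2*m∸1 zero    = refl
m+[m∸1]≡2*m∸1 (suc m) = sym (trans (+-suc m (m + 0)) (cong (λ x → suc (m + x)) (+-identityʳ m)))

negate : ∀ {n} → Literal n → Literal n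
negate (j , b) = j , not b

literal-of-variable : ∀ {n} (l l′ : Literal n) → proj₁ l ≡ proj₁ l′ → l ≡ l′ ⊎ l ≡ negate l′
literal-of-variable (j , true)  (.j , true)  refl = inj₁ refl
literal-of-variable (j , false) (.j , false) refl = inj₁ refl
literal-of-variable (j , true)  (.j , false) refl = inj₂ refl
literal-of-variable (j , false) (.j , true)  refl = inj₂ refl

truthBit : Bool → Bool → Fin 2
truthBit true  true  = suc zero
truthBit false false = suc zero
truthBit true  false = zero
truthBit false true  = zero

truthBit-true≢false : ∀ a → truthBit a true ≢ truthBit a false
truthBit-true≢false true  ()
truthBit-true≢false false ()

module _ {K : ℕ} (φ : Instance (3 + K)) (α : Fin (n φ) → Bool) where

  #subs : ℕ
  #subs = m φ * ((3 + K) * (2 * (3 + K) * (2 * suc K)))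

  #us : ℕ
  #us = m φ * (2 * (3 + K))

  Code : Set
  Code = Fin #subs ⊎ Fin #us ⊎ Literal (n φ)

  code : VG φ → Code
  code (sub i p k c t) = inj₁ (combine i (combine p (combine k (combine c t))))
  code (uV i k)        = inj₂ (inj₁ (combine i k))
  code (pos j)         = inj₂ (inj₂ (j , true))
  code (neg j)         = inj₂ (inj₂ (j , false))

  code-injective : Injective _≡_ _≡_ code
  code-injective {sub i p k c t} {sub i′ p′ k′ c′ t′} eq
    with refl , eq ← combine-injective i _ i′ _ (inj₁-injective eq)
    with refl , eq ← combine-injective p _ p′ _ eq
    with refl , eq ← combine-injective k _ k′ _ eq
    with refl , refl ← combine-injective c t c′ t′ eq = refl
  code-injective {uV i k} {uV i′ k′} eq
    with refl , refl ← combine-injective i k i′ k′ (inj₁-injective (inj₂-injective eq)) = refl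
  code-injective {pos _} {pos _} refl = refl
  code-injective {neg _} {neg _} refl = refl
  code-injective {sub _ _ _ _ _} {uV _ _} ()
  code-injective {sub _ _ _ _ _} {pos _} ()
  code-injective {sub _ _ _ _ _} {neg _} ()
  code-injective {uV _ _} {sub _ _ _ _ _} ()
  code-injective {uV _ _} {pos _} ()
  code-injective {uV _ _} {neg _} ()
  code-injective {pos _} {sub _ _ _ _ _} ()
  code-injective {pos _} {uV _ _} ()
  code-injective {pos _} {neg _} ()
  code-injective {neg _} {sub _ _ _ _ _} ()
  code-injective {neg _} {uV _ _} ()
  code-injective {neg _} {pos _} ()

  literalRank : Literal (n φ) → ℕ
  literalRank (j , b) = toℕ (combine j (truthBit (α j) b))

  literalRank-injective : Injective _≡_ _≡_ literalRank
  literalRank-injective {j , b} {j′ , b′} eq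
    with refl , bits ← combine-injective j _ j′ _ (toℕ-injective eq)
    with b | b′
  ... | true  | true  = refl
  ... | false | false = refl
  ... | true  | false = ⊥-elim (truthBit-true≢false (α j) bits)
  ... | false | true  = ⊥-elim (truthBit-true≢false (α j) (sym bits))

  codeRank : Code → ℕ
  codeRank (inj₁ s)        = toℕ s
  codeRank (inj₂ (inj₁ u)) = #subs + toℕ u
  codeRank (inj₂ (inj₂ l)) = #subs + (#us + literalRank l)

  codeRank-injective : Injective _≡_ _≡_ codeRank
  codeRank-injective {inj₁ s} {inj₁ s′} eq = cong inj₁ (toℕ-injective eq)
  codeRank-injective {inj₁ s} {inj₂ (inj₁ _)} eq = ⊥-elim (<-≢-+ _ (toℕ<n s) eq)
  codeRank-injective {inj₁ s} {inj₂ (inj₂ _)} eq = ⊥-elim (<-≢-+ _ (toℕ<n s) eq)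
  codeRank-injective {inj₂ (inj₁ _)} {inj₁ s} eq = ⊥-elim (<-≢-+ _ (toℕ<n s) (sym eq))
  codeRank-injective {inj₂ (inj₂ _)} {inj₁ s} eq = ⊥-elim (<-≢-+ _ (toℕ<n s) (sym eq))
  codeRank-injective {inj₂ (inj₁ u)} {inj₂ (inj₁ u′)} eq =
    cong (inj₂ ∘ inj₁) (toℕ-injective (+-cancelˡ-≡ #subs _ _ eq))
  codeRank-injective {inj₂ (inj₁ u)} {inj₂ (inj₂ _)} eq =
    ⊥-elim (<-≢-+ _ (toℕ<n u) (+-cancelˡ-≡ #subs _ _ eq))
  codeRank-injective {inj₂ (inj₂ _)} {inj₂ (inj₁ u)} eq =
    ⊥-elim (<-≢-+ _ (toℕ<n u) (sym (+-cancelˡ-≡ #subs _ _ eq)))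
  codeRank-injective {inj₂ (inj₂ l)} {inj₂ (inj₂ l′)} eq =
    cong (inj₂ ∘ inj₂) (literalRank-injective (+-cancelˡ-≡ #us _ _ (+-cancelˡ-≡ #subs _ _ eq)))

  rank : VG φ → ℕ
  rank = codeRank ∘ code

  rank-injective : Injective _≡_ _≡_ rank
  rank-injective = code-injective ∘ codeRank-injective

  rank-sub<rank-uV : ∀ i p k c t i′ k′ → rank (sub i p k c t) < rank (uV i′ k′)
  rank-sub<rank-uV _ _ _ _ _ _ _ = <-≤-trans (toℕ<n _) (m≤m+n _ _)

  rank-uV<rank-literal : ∀ i k l → rank (uV i k) < rank (litVertex l)
  rank-uV<rank-literal _ _ (_ , true)  = +-monoʳ-< #subs (<-≤-trans (toℕ<n _) (m≤m+n _ _))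
  rank-uV<rank-literal _ _ (_ , false) = +-monoʳ-< #subs (<-≤-trans (toℕ<n _) (m≤m+n _ _))

  rank-sub<rank-literal : ∀ i p k c t l → rank (sub i p k c t) < rank (litVertex l)
  rank-sub<rank-literal i p k c t l = <-trans (rank-sub<rank-uV i p k c t i k) (rank-uV<rank-literal i k l)

  rank-negate<rank-true : ∀ l → α (proj₁ l) ≡ proj₂ l → rank (litVertex (negate l)) < rank (litVertex l)
  rank-negate<rank-true (j , true)  αj≡b rewrite αj≡b =
    +-monoʳ-< #subs (+-monoʳ-< #us (toℕ-combine-zero<toℕ-combine-one j))
  rank-negate<rank-true (j , false) αj≡b rewrite αj≡b =
    +-monoʳ-< #subs (+-monoʳ-< #us (toℕ-combine-zero<toℕ-combine-one j))

  -- Sub-vertex t of an edge is toℕ t + 1 steps from its literal end and K + 1 − toℕ t from its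
  -- u-vertex. A walk is far once no literal is within r steps any more: after more than r
  -- steps at a literal, at least r at a sub-vertex, or at least r − 1 at a u-vertex.
  Far : ℕ → Set
  Far ℓ = 3 + K < ℓ

  -- An over-approximation, indexed by the number ℓ of steps taken, of where a walk can be
  -- whose vertices other than the last have rank at most rank v; it only has to be closed
  -- under the seven ways of traversing an edge of G φ.
  record Invariant (v : VG φ) : Set₁ where
    field
      AtU   : ℕ → Fin (m φ) → Fin (2 * (3 + K)) → Set
      AtSub : ℕ → Fin (m φ) → Fin (3 + K) → Fin (2 * (3 + K)) → Fin 2 → Fin (suc K) → Set
      AtLit : ℕ → Literal (n φ) → Set
      flip-var : ∀ {ℓ l} → AtLit ℓ l → rank (litVertex l) ≤ rank v → AtLit (suc ℓ) (negate l)
      enter    : ∀ {ℓ i p k c t} → toℕ t ≡ 0 → AtLit ℓ (lit φ i p) →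
                 rank (litVertex (lit φ i p)) ≤ rank v → AtSub (suc ℓ) i p k c t
      exit     : ∀ {ℓ i p k c t} → toℕ t ≡ 0 → AtSub ℓ i p k c t →
                 rank (sub i p k c t) ≤ rank v → AtLit (suc ℓ) (lit φ i p)
      up       : ∀ {ℓ i p k c t t′} → toℕ t′ ≡ suc (toℕ t) → AtSub ℓ i p k c t →
                 rank (sub i p k c t) ≤ rank v → AtSub (suc ℓ) i p k c t′
      down     : ∀ {ℓ i p k c t t′} → toℕ t′ ≡ suc (toℕ t) → AtSub ℓ i p k c t′ →
                 rank (sub i p k c t′) ≤ rank v → AtSub (suc ℓ) i p k c t
      arrive   : ∀ {ℓ i p k c t} → toℕ t ≡ K → AtSub ℓ i p k c t →
                 rank (sub i p k c t) ≤ rank v → AtU (suc ℓ) i k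
      depart   : ∀ {ℓ i p k c t} → toℕ t ≡ K → AtU ℓ i k →
                 rank (uV i k) ≤ rank v → AtSub (suc ℓ) i p k c t

    At : ℕ → VG φ → Set
    At ℓ (uV i k)        = AtU ℓ i k
    At ℓ (pos j)         = AtLit ℓ (j , true)
    At ℓ (neg j)         = AtLit ℓ (j , false)
    At ℓ (sub i p k c t) = AtSub ℓ i p k c t

    At-litVertex⁺ : ∀ {ℓ} l → AtLit ℓ l → At ℓ (litVertex l)
    At-litVertex⁺ (_ , true)  at = at
    At-litVertex⁺ (_ , false) at = at

    At-litVertex⁻ : ∀ {ℓ} l → At ℓ (litVertex l) → AtLit ℓ l
    At-litVertex⁻ (_ , true)  at = at
    At-litVertex⁻ (_ , false) at = at

    At-step : ∀ {ℓ x y} → rank x ≤ rank v → At ℓ x → Adj (G φ) x y → At (suc ℓ) y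
    At-step x≤v at (inj₁ (var _))                = flip-var at x≤v
    At-step x≤v at (inj₂ (var _))                = flip-var at x≤v
    At-step x≤v at (inj₁ (first _ _ _ _ _ t≡0))  = enter t≡0 (At-litVertex⁻ _ at) x≤v
    At-step x≤v at (inj₂ (first _ _ _ _ _ t≡0))  = At-litVertex⁺ _ (exit t≡0 at x≤v)
    At-step x≤v at (inj₁ (step _ _ _ _ _ _ t′≡)) = up t′≡ at x≤v
    At-step x≤v at (inj₂ (step _ _ _ _ _ _ t′≡)) = down t′≡ at x≤v
    At-step x≤v at (inj₁ (last _ _ _ _ _ t≡))    = arrive (suc-injective t≡) at x≤v
    At-step x≤v at (inj₂ (last _ _ _ _ _ t≡))    = depart (suc-injective t≡) at x≤v

  WeaklyReaches : VG φ → VG φ → Set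
  WeaklyReaches = WReach (G φ) (3 + K) rank

  reach : ∀ {a v} (I : Invariant v) → Invariant.At I 0 a → WeaklyReaches a v →
          ∃[ ℓ ] ℓ ≤ 3 + K × Invariant.At I ℓ v
  reach {v = v} I start (_ , a≤v , xs , walk , _ , short , below) =
    length xs + 1 , short ,
    invariant-along-Chain (G φ) (λ x → rank x ≤ rank v) (Invariant.At I) (Invariant.At-step I)
      xs a≤v (All.map <⇒≤ below) start walk

  reach-literal : ∀ {a l} (I : Invariant (litVertex l)) → Invariant.At I 0 a → WeaklyReaches a (litVertex l) →
                  ∃[ ℓ ] ℓ ≤ 3 + K × Invariant.AtLit I ℓ l
  reach-literal {l = l} I start w with ℓ , ℓ≤r , at ← reach I start w =
    ℓ , ℓ≤r , Invariant.At-litVertex⁻ I l at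

  ¬Far : ∀ {ℓ} → ℓ ≤ 3 + K → ¬ Far ℓ
  ¬Far ℓ≤r far = <⇒≱ far ℓ≤r

  ¬wreach-downwards : ∀ {a v} → rank v < rank a → ¬ WeaklyReaches a v
  ¬wreach-downwards v<a (_ , a≤v , _) = <⇒≱ v<a a≤v

  -- Below a u-vertex only sub- and u-vertices can be used, and these form stars around the u-vertices.
  star : ∀ i₀ k₀ {i k} → Invariant (uV i k)
  star i₀ k₀ {i} {k} = record
    { AtU      = λ _ i′ k′ → i′ ≡ i₀ × k′ ≡ k₀
    ; AtSub    = λ _ i′ _ k′ _ _ → i′ ≡ i₀ × k′ ≡ k₀
    ; AtLit    = λ _ _ → ⊤
    ; flip-var = λ _ _ → tt
    ; enter    = λ {_} {i′} {p′} _ _ lit≤u →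
                   ⊥-elim (<⇒≱ (rank-uV<rank-literal i k (lit φ i′ p′)) lit≤u)
    ; exit     = λ _ _ _ → tt
    ; up       = λ _ at _ → at
    ; down     = λ _ at _ → at
    ; arrive   = λ _ at _ → at
    ; depart   = λ _ at _ → at
    }

  -- Below a sub-vertex only sub-vertices can be used, and these form the subdivided edges.
  within-edge : ∀ i₀ p₀ k₀ c₀ {i p k c t} → Invariant (sub i p k c t)
  within-edge i₀ p₀ k₀ c₀ {i} {p} {k} {c} {t} = record
    { AtU      = λ _ _ _ → ⊤
    ; AtSub    = λ _ i′ p′ k′ c′ _ → i′ ≡ i₀ × p′ ≡ p₀ × k′ ≡ k₀ × c′ ≡ c₀
    ; AtLit    = λ _ _ → ⊤
    ; flip-var = λ _ _ → tt
    ; enter    = λ {_} {i′} {p′} _ _ lit≤s →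
                   ⊥-elim (<⇒≱ (rank-sub<rank-literal i p k c t (lit φ i′ p′)) lit≤s)
    ; exit     = λ _ _ _ → tt
    ; up       = λ _ at _ → at
    ; down     = λ _ at _ → at
    ; arrive   = λ _ _ _ → tt
    ; depart   = λ {_} {i′} {_} {k′} _ _ u≤s →
                   ⊥-elim (<⇒≱ (rank-sub<rank-uV i p k c t i′ k′) u≤s)
    }

  module FromLiteral (j₀ : Fin (n φ)) {v : VG φ} where

    data AtLit (ℓ : ℕ) (l : Literal (n φ)) : Set where
      of-variable : proj₁ l ≡ j₀ → AtLit ℓ l
      far         : Far ℓ → AtLit ℓ l

    data AtSub (ℓ : ℕ) (i : Fin (m φ)) (p : Fin (3 + K)) (k : Fin (2 * (3 + K))) (c : Fin 2) (t : Fin (suc K)) :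
               Set where
      from-variable : proj₁ (lit φ i p) ≡ j₀ → toℕ t < ℓ → AtSub ℓ i p k c t
      far           : 3 + K ≤ ℓ → AtSub ℓ i p k c t

    invariant : Invariant v
    invariant = record
      { AtU      = λ ℓ _ _ → 2 + K ≤ ℓ
      ; AtSub    = AtSub
      ; AtLit    = AtLit
      ; flip-var = λ where
          (of-variable e) _ → of-variable e
          (far f)         _ → far (m≤n⇒m≤1+n f)
      ; enter    = λ where
          t≡0 (of-variable e) _ → from-variable e (subst (_< suc _) (sym t≡0) (s≤s z≤n))
          _   (far f)         _ → far (m<n⇒m≤1+n f)
      ; exit     = λ where
          _ (from-variable e _) _ → of-variable e
          _ (far h)             _ → far (s≤s h)
      ; up       = λ where
          t′≡ (from-variable e t<ℓ) _ → from-variable e (subst (_< suc _) (sym t′≡) (s≤s t<ℓ))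
          _   (far h)               _ → far (m≤n⇒m≤1+n h)
      ; down     = λ where
          t′≡ (from-variable e t′<ℓ) _ →
            from-variable e (m<n⇒m<1+n (<-trans (n<1+n _) (subst (_< _) t′≡ t′<ℓ)))
          _   (far h)                _ → far (m≤n⇒m≤1+n h)
      ; arrive   = λ where
          t≡K (from-variable _ t<ℓ) _ → s≤s (subst (_< _) t≡K t<ℓ)
          _   (far h)               _ → m<n⇒m≤1+n h
      ; depart   = λ _ h _ → far (s≤s h)
      }

  module FromU (i₀ : Fin (m φ)) (k₀ : Fin (2 * (3 + K))) {v : VG φ} where

    data AtU (ℓ : ℕ) : Fin (m φ) → Fin (2 * (3 + K)) → Set where
      start : AtU ℓ i₀ k₀
      far   : ∀ {i k} → 2 + K ≤ ℓ → AtU ℓ i k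

    data AtSub (ℓ : ℕ) : Fin (m φ) → Fin (3 + K) → Fin (2 * (3 + K)) → Fin 2 → Fin (suc K) → Set where
      on-star : ∀ {p c t} → suc K ≤ ℓ + toℕ t → AtSub ℓ i₀ p k₀ c t
      far      : ∀ {i p k c t} → 3 + K ≤ ℓ → AtSub ℓ i p k c t

    data AtLit (ℓ : ℕ) (l : Literal (n φ)) : Set where
      in-clause : ∀ q → lit φ i₀ q ≡ l → 2 + K ≤ ℓ → AtLit ℓ l
      negated   : ∀ q → negate (lit φ i₀ q) ≡ l → rank (litVertex (lit φ i₀ q)) ≤ rank v → 3 + K ≤ ℓ →
                  AtLit ℓ l
      far       : Far ℓ → AtLit ℓ l

    invariant : Invariant v
    invariant = record
      { AtU      = AtU
      ; AtSub    = AtSub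
      ; AtLit    = AtLit
      ; flip-var = λ where
          (in-clause q refl h)   lit≤v → negated q refl lit≤v (s≤s h)
          (negated _ _ _ h)      _     → far (s≤s h)
          (far f)                _     → far (m≤n⇒m≤1+n f)
      ; enter    = λ where
          _ (in-clause _ _ h)    _ → far (s≤s h)
          _ (negated _ _ _ h)    _ → far (m≤n⇒m≤1+n h)
          _ (far f)              _ → far (m<n⇒m≤1+n f)
      ; exit     = λ where
          t≡0 (on-star {p} h) _ →
            in-clause p refl (s≤s (subst (suc K ≤_) (trans (cong (_+_ _) t≡0) (+-identityʳ _)) h))
          _   (far h)          _ → far (s≤s h)
      ; up       = λ where
          t′≡ (on-star h) _ →
            on-star (≤-trans h (+-mono-≤ (n≤1+n _) (subst (_ ≤_) (sym t′≡) (n≤1+n _))))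
          _   (far h)      _ → far (m≤n⇒m≤1+n h)
      ; down     = λ where
          t′≡ (on-star h) _ → on-star (≤-trans h (≤-reflexive (trans (cong (_+_ _) t′≡) (+-suc _ _))))
          _   (far h)      _ → far (m≤n⇒m≤1+n h)
      ; arrive   = λ where
          _ (on-star _) _ → start
          _ (far h)      _ → far (m<n⇒m≤1+n h)
      ; depart   = λ where
          t≡K start   _ → on-star (s≤s (subst (λ t → K ≤ _ + t) (sym t≡K) (m≤n+m K _)))
          _   (far h) _ → far (s≤s h)
      }

  module FromSub (i₀ : Fin (m φ)) (p₀ : Fin (3 + K)) (k₀ : Fin (2 * (3 + K))) (c₀ : Fin 2) (t₀ : Fin (suc K))
                 {v : VG φ} where

    j₀ : Fin (n φ)
    j₀ = proj₁ (lit φ i₀ p₀)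

    s₀ : ℕ
    s₀ = toℕ t₀

    data AtU (ℓ : ℕ) : Fin (m φ) → Fin (2 * (3 + K)) → Set where
      own-u : suc K ≤ ℓ + s₀ → AtU ℓ i₀ k₀
      far   : ∀ {i k} → 2 + K ≤ ℓ → AtU ℓ i k

    data AtSub (ℓ : ℕ) : Fin (m φ) → Fin (3 + K) → Fin (2 * (3 + K)) → Fin 2 → Fin (suc K) → Set where
      own-edge      : ∀ {t} → toℕ t ≤ ℓ + s₀ → AtSub ℓ i₀ p₀ k₀ c₀ t
      via-own-u     : ∀ {p c t} → 2 + (K + K) ≤ ℓ + s₀ + toℕ t → AtSub ℓ i₀ p k₀ c t
      from-variable : ∀ {i p k c t} → proj₁ (lit φ i p) ≡ j₀ → toℕ t < ℓ → AtSub ℓ i p k c t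
      far           : ∀ {i p k c t} → 3 + K ≤ ℓ → AtSub ℓ i p k c t

    data AtLit (ℓ : ℕ) (l : Literal (n φ)) : Set where
      of-variable : proj₁ l ≡ j₀ → AtLit ℓ l
      in-clause   : ∀ q → lit φ i₀ q ≡ l → 3 + K ≤ ℓ → AtLit ℓ l
      far         : Far ℓ → AtLit ℓ l

    -- Going round through u_{i₀}^{k₀} to another literal of clause i₀ costs 2r − 3 − s₀ ≥ r steps.
    via-own-u-far : ∀ {ℓ} → 2 + (K + K) ≤ ℓ + s₀ → 3 + K ≤ suc ℓ
    via-own-u-far {ℓ} h = s≤s (+-cancelʳ-≤ K (2 + K) ℓ (≤-trans h (+-monoʳ-≤ ℓ (≤-pred (toℕ<n t₀)))))

    invariant : Invariant v
    invariant = record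
      { AtU      = AtU
      ; AtSub    = AtSub
      ; AtLit    = AtLit
      ; flip-var = λ where
          (of-variable e)   _ → of-variable e
          (in-clause _ _ h) _ → far (s≤s h)
          (far f)           _ → far (m≤n⇒m≤1+n f)
      ; enter    = λ where
          t≡0 (of-variable e)   _ → from-variable e (subst (_< suc _) (sym t≡0) (s≤s z≤n))
          _   (in-clause _ _ h) _ → far (m≤n⇒m≤1+n h)
          _   (far f)           _ → far (m<n⇒m≤1+n f)
      ; exit     = λ where
          _   (own-edge _)          _ → of-variable refl
          t≡0 (via-own-u {p} h)     _ →
            in-clause p refl
              (via-own-u-far (subst (2 + (K + K) ≤_) (trans (cong (_+_ _) t≡0) (+-identityʳ _)) h))
          _   (from-variable e _)   _ → of-variable e
          _   (far h)               _ → far (s≤s h)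
      ; up       = λ where
          t′≡ (own-edge h)          _ → own-edge (subst (_≤ _) (sym t′≡) (s≤s h))
          t′≡ (via-own-u h)         _ →
            via-own-u (≤-trans h (+-mono-≤ (n≤1+n _) (subst (_ ≤_) (sym t′≡) (n≤1+n _))))
          t′≡ (from-variable e h)   _ → from-variable e (subst (_< suc _) (sym t′≡) (s≤s h))
          _   (far h)               _ → far (m≤n⇒m≤1+n h)
      ; down     = λ where
          t′≡ (own-edge h)          _ → own-edge (m<n⇒m≤1+n (subst (_≤ _) t′≡ h))
          t′≡ (via-own-u h)         _ →
            via-own-u (≤-trans h (≤-reflexive (trans (cong (_+_ _) t′≡) (+-suc _ _))))
          t′≡ (from-variable e h)   _ →
            from-variable e (m<n⇒m<1+n (<-trans (n<1+n _) (subst (_< _) t′≡ h)))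
          _   (far h)               _ → far (m≤n⇒m≤1+n h)
      ; arrive   = λ where
          t≡K (own-edge h)          _ → own-u (s≤s (subst (_≤ _) t≡K h))
          t≡K (via-own-u h)         _ →
            own-u (m<n⇒m≤1+n (+-cancelʳ-≤ K (2 + K) _ (subst (λ t → _ ≤ _ + t) t≡K h)))
          t≡K (from-variable _ h)   _ → far (s≤s (subst (_< _) t≡K h))
          _   (far h)               _ → far (m<n⇒m≤1+n h)
      ; depart   = λ where
          t≡K (own-u h) _ → via-own-u (subst (λ t → _ ≤ suc (_ + t)) (sym t≡K) (s≤s (+-monoˡ-≤ K h)))
          _   (far h)   _ → far (s≤s h)
      }

  module _ (sat : ∀ i → ∃[ p ] α (proj₁ (lit φ i p)) ≡ proj₂ (lit φ i p)) where

    clauseVertices : Fin (m φ) → List (VG φ)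
    clauseVertices i = map (litVertex ∘ lit φ i) (allFin (3 + K))

    ∈-clauseVertices : ∀ i q → litVertex (lit φ i q) ∈ clauseVertices i
    ∈-clauseVertices i q = ∈-map⁺ (litVertex ∘ lit φ i) (∈-allFin q)

    -- punchIn (proj₁ (sat i)) skips a true literal of clause i, whose negation is not reachable.
    wreachList : VG φ → List (VG φ)
    wreachList (uV i k)        = clauseVertices i ++
                                 map (litVertex ∘ negate ∘ lit φ i ∘ punchIn (proj₁ (sat i))) (allFin (2 + K))
    wreachList (sub i p k c t) = uV i k ∷ litVertex (negate (lit φ i p)) ∷
                                 clauseVertices i ++ map (sub i p k c ∘ punchIn t) (allFin K)
    wreachList (pos j)         = pos j ∷ neg j ∷ []
    wreachList (neg j)         = pos j ∷ neg j ∷ []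

    length-clauseVertices : ∀ i → length (clauseVertices i) ≡ 3 + K
    length-clauseVertices i = length-map-allFin (3 + K) _

    length-wreachList : ∀ a → length (wreachList a) ≤ 2 * (3 + K) ∸ 1
    length-wreachList (uV i k) = ≤-reflexive (begin
      length (clauseVertices i ++ _)   ≡⟨ length-++ (clauseVertices i) ⟩
      length (clauseVertices i) + _    ≡⟨ cong₂ _+_ (length-clauseVertices i) (length-map-allFin (2 + K) _) ⟩
      (3 + K) + (2 + K)                ≡⟨ m+[m∸1]≡2*m∸1 (3 + K) ⟩
      2 * (3 + K) ∸ 1                  ∎)
      where open ≡-Reasoning
    length-wreachList (sub i p k c t) = ≤-reflexive (begin
      2 + length (clauseVertices i ++ _)   ≡⟨ cong (2 +_) (length-++ (clauseVertices i)) ⟩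
      2 + (length (clauseVertices i) + _)  ≡⟨ cong (2 +_) (cong₂ _+_ (length-clauseVertices i) (length-map-allFin K _)) ⟩
      2 + ((3 + K) + K)                    ≡⟨ cong suc (sym (+-suc (3 + K) K)) ⟩
      suc ((3 + K) + suc K)                ≡⟨ sym (+-suc (3 + K) (suc K)) ⟩
      (3 + K) + (2 + K)                    ≡⟨ m+[m∸1]≡2*m∸1 (3 + K) ⟩
      2 * (3 + K) ∸ 1                      ∎)
      where open ≡-Reasoning
    length-wreachList (pos j) = s≤s (s≤s z≤n)
    length-wreachList (neg j) = s≤s (s≤s z≤n)

    wreach-literal-variable : ∀ l₀ l → WeaklyReaches (litVertex l₀) (litVertex l) → proj₁ l ≡ proj₁ l₀
    wreach-literal-variable l₀ l w
      with reach-literal (FromLiteral.invariant _)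
             (Invariant.At-litVertex⁺ _ l₀ (FromLiteral.of-variable refl)) w
    ... | _ , _   , FromLiteral.of-variable e = e
    ... | _ , ℓ≤r , FromLiteral.far f         = ⊥-elim (¬Far ℓ≤r f)

    wreach-from-literal : ∀ l₀ v → WeaklyReaches (litVertex l₀) v → v ∈ pos (proj₁ l₀) ∷ neg (proj₁ l₀) ∷ []
    wreach-from-literal l₀ (uV i k)        w = ⊥-elim (¬wreach-downwards (rank-uV<rank-literal i k l₀) w)
    wreach-from-literal l₀ (sub i p k c t) w = ⊥-elim (¬wreach-downwards (rank-sub<rank-literal i p k c t l₀) w)
    wreach-from-literal l₀ (pos j)         w with refl ← wreach-literal-variable l₀ (j , true) w = here refl
    wreach-from-literal l₀ (neg j)         w with refl ← wreach-literal-variable l₀ (j , false) w = there (here refl)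

    module _ {i : Fin (m φ)} {k : Fin (2 * (3 + K))} where

      ∈-negated : ∀ q → rank (litVertex (lit φ i q)) ≤ rank (litVertex (negate (lit φ i q))) →
                  litVertex (negate (lit φ i q)) ∈ wreachList (uV i k)
      ∈-negated q q≤¬q with proj₁ (sat i) ≟ q
      ... | yes refl = ⊥-elim (<⇒≱ (rank-negate<rank-true (lit φ i q) (proj₂ (sat i))) q≤¬q)
      ... | no  p≢q  = ∈-++⁺ʳ (clauseVertices i) (∈-map-punchIn (litVertex ∘ negate ∘ lit φ i) p≢q)

      wreach-literal-from-uV : ∀ l → WeaklyReaches (uV i k) (litVertex l) → litVertex l ∈ wreachList (uV i k)
      wreach-literal-from-uV l w with reach-literal (FromU.invariant i k) FromU.start w
      ... | _ , _   , FromU.in-clause q refl _    = ∈-++⁺ˡ (∈-clauseVertices i q)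
      ... | _ , _   , FromU.negated q refl q≤¬q _ = ∈-negated q q≤¬q
      ... | _ , ℓ≤r , FromU.far f                 = ⊥-elim (¬Far ℓ≤r f)

      wreach-from-uV : ∀ v → WeaklyReaches (uV i k) v → v ∈ wreachList (uV i k)
      wreach-from-uV (uV i′ k′) w
        with _ , _ , refl , refl ← reach (star i k) (refl , refl) w = ⊥-elim (proj₁ w refl)
      wreach-from-uV (sub i′ p′ k′ c′ t′) w =
        ⊥-elim (¬wreach-downwards (rank-sub<rank-uV i′ p′ k′ c′ t′ i k) w)
      wreach-from-uV (pos j) w = wreach-literal-from-uV (j , true) w
      wreach-from-uV (neg j) w = wreach-literal-from-uV (j , false) w

    module _ {i : Fin (m φ)} {p : Fin (3 + K)} {k : Fin (2 * (3 + K))} {c : Fin 2} {t : Fin (suc K)} where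

      ∈-of-variable : ∀ l → proj₁ l ≡ proj₁ (lit φ i p) → litVertex l ∈ wreachList (sub i p k c t)
      ∈-of-variable l e with literal-of-variable l (lit φ i p) e
      ... | inj₁ refl = there (there (∈-++⁺ˡ (∈-clauseVertices i p)))
      ... | inj₂ refl = there (here refl)

      wreach-literal-from-sub : ∀ l → WeaklyReaches (sub i p k c t) (litVertex l) →
                                litVertex l ∈ wreachList (sub i p k c t)
      wreach-literal-from-sub l w with reach-literal (FromSub.invariant i p k c t) (FromSub.own-edge ≤-refl) w
      ... | _ , _   , FromSub.of-variable e     = ∈-of-variable l e
      ... | _ , _   , FromSub.in-clause q refl _ = there (there (∈-++⁺ˡ (∈-clauseVertices i q)))
      ... | _ , ℓ≤r , FromSub.far f             = ⊥-elim (¬Far ℓ≤r f)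

      wreach-from-sub : ∀ v → WeaklyReaches (sub i p k c t) v → v ∈ wreachList (sub i p k c t)
      wreach-from-sub (uV i′ k′) w with _ , _ , refl , refl ← reach (star i k) (refl , refl) w = here refl
      wreach-from-sub (sub i′ p′ k′ c′ t′) w
        with _ , _ , refl , refl , refl , refl ← reach (within-edge i p k c) (refl , refl , refl , refl) w =
        there (there (∈-++⁺ʳ (clauseVertices i)
          (∈-map-punchIn (sub i p k c) (proj₁ w ∘ cong (sub i p k c)))))
      wreach-from-sub (pos j) w = wreach-literal-from-sub (j , true) w
      wreach-from-sub (neg j) w = wreach-literal-from-sub (j , false) w

    wreach⊆wreachList : ∀ a v → WeaklyReaches a v → v ∈ wreachList a
    wreach⊆wreachList (uV _ _)        = wreach-from-uV
    wreach⊆wreachList (sub _ _ _ _ _) = wreach-from-sub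
    wreach⊆wreachList (pos j)         = wreach-from-literal (j , true)
    wreach⊆wreachList (neg j)         = wreach-from-literal (j , false)

lemma3 : (r : ℕ) → 3 ≤ r → (φ : Instance r) → Satisfiable φ →
    WcolAtMost (G φ) r (2 * r ∸ 1)
lemma3 (suc (suc (suc K))) (s≤s (s≤s (s≤s z≤n))) φ (α , sat) =
  rank φ α , rank-injective φ α ,
  λ a → wreachList φ α sat a , length-wreachList φ α sat a , wreach⊆wreachList φ α sat a
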